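{- Let $w\in S_n$ and let $D\in RP(w)$ be a highest weight pipe dream. For each row $i$ containing at least $\ell$ crosses, let $j^i_\ell$ be the column index of the $\ell$-th cross from the left in row $i$ of $D$. Then for every fixed $1\le\ell\le\operatorname{wt}(D)_1$, the sequence $(j^i_\ell+i-1)$, indexed by the rows $i$ containing at least $\ell$ crosses, is strictly increasing in $i$.
   Context: Index the boxes of the $n\times n$ grid by $(i,j)$, row $i$ from the top, column $j$ from the left. Pipe dreams. A pipe dream is a covering of each box by a cross tile or an elbow tile, where crosses are only allowed in boxes with $i+j\le n$. Connecting tiles gives pipes that enter at the left of each row and exit at the top of a column: a cross lets one pipe pass horizontally and one vertically; an elbow joins the left edge to the top edge and the bottom edge to the right edge. $D$ is a pipe dream for $w$ if the pipe entering row $i$ exits from column $w(i)$. It is reduced if any two pipes cross at most once. $RP(w)$ is the set of reduced pipe dreams for $w$, and $D_+$ is the set of boxes carrying crosses. $\operatorname{wt}(D)$ has $i$-th coordinate equal to the number of crosses in row $i$. Pairing process on row $i$. The crosses of row $i$ are considered from right to left. The cross $(i,j)$ is paired with the leftmost not-yet-paired cross of row $i+1$ in a column $\ge j$, if one exists; otherwise it is unpaired. Crosses of row $i+1$ never paired are unpaired. Raising move $e_i$. If every cross of row $i+1$ is paired, set $e_i(D)=0$. Otherwise let $(i+1,\ell)$ be the rightmost unpaired cross of row $i+1$, let $q>\ell$ be minimal with $(i+1,q)\notin D_+$, and set $e_i(D)_+=(D_+\setminus\{(i+1,\ell)\})\cup\{(i,q)\}$. $D$ is a highest weight pipe dream if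 $e_i(D)=0$ for all $1\le i<n$. -}

module Defs where

open import Data.Nat using (ℕ; zero; suc; pred; _+_; _*_; _∸_; _≤_; _<_; _≤ᵇ_; _≡ᵇ_)
open import Data.Bool using (Bool; true; false; if_then_else_; _∧_; _∨_)
open import Data.List using (List; []; _∷_; filter; reverse; foldl; length; upTo; map)
open import Data.Bool.ListAction using (any)
open import Data.Maybe using (Maybe; just; nothing)
open import Data.Product using (_×_; _,_; proj₁; proj₂; Σ)
open import Data.Fin using (Fin; toℕ)
open import Data.Fin.Permutation using (Permutation′; _⟨$⟩ʳ_)
open import Relation.Binary.PropositionalEquality using (_≡_; _≢_)
open import Relation.Nullary.Decidable using (does)

-- A (candidate) pipe dream on the n×n grid is given by its set of crosses
-- D₊, encoded as a Boolean predicate on 1-indexed positions (row, column):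
-- D i j ≡ true  iff box (i,j) carries a cross; otherwise it is an elbow.

Crosses : Set
Crosses = ℕ → ℕ → Bool

IsPipeDream : ℕ → Crosses → Set
IsPipeDream n D = ∀ i j → D i j ≡ true → (1 ≤ i) × (1 ≤ j) × (i + j ≤ n)

-- Tracing pipes.  H: the pipe enters the box from its left edge,
-- V: the pipe enters the box from its bottom edge.

data Dir : Set where
  H V : Dir

Step : Set
Step = ℕ × ℕ × Dir

-- walk D fuel r c d : the list of boxes visited by the pipe that enters box
-- (r,c) in direction d, together with the column at whose top it exits the
-- grid (through row 1), if it does so within the fuel.
walk : Crosses → ℕ → ℕ → ℕ → Dir → List Step × Maybe ℕ
walk D zero r c d = [] , nothing
walk D (suc k) r c d = go (D r c) d
  where
  cons : Step → List Step × Maybe ℕ → List Step × Maybe ℕ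
  cons s (ps , e) = (s ∷ ps) , e
  up : List Step × Maybe ℕ
  up = if r ≤ᵇ 1 then ((r , c , d) ∷ []) , just c
       else cons (r , c , d) (walk D k (pred r) c V)
  right : List Step × Maybe ℕ
  right = cons (r , c , d) (walk D k r (suc c) H)
  go : Bool → Dir → List Step × Maybe ℕ
  go true  H = right
  go true  V = up
  go false H = up      -- elbow: left edge joined to top edge
  go false V = right   -- elbow: bottom edge joined to right edge

-- The pipe entering the left of row i (fuel 2n suffices: each step moves
-- up or right inside the n×n grid).
pipe : ℕ → Crosses → ℕ → List Step × Maybe ℕ
pipe n D i = walk D (2 * n) i 1 H

pipePath : ℕ → Crosses → ℕ → List Step
pipePath n D i = proj₁ (pipe n D i)

exitColumn : ℕ → Crosses → ℕ → Maybe ℕ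
exitColumn n D i = proj₂ (pipe n D i)

-- D is a pipe dream for w (w ∈ S_n given as a permutation of Fin n,
-- shifted to 1-indexing): the pipe entering row i exits from column w(i).
IsPipeDreamFor : (n : ℕ) → Permutation′ n → Crosses → Set
IsPipeDreamFor n w D =
  IsPipeDream n D ×
  (∀ (i : Fin n) → exitColumn n D (suc (toℕ i)) ≡ just (suc (toℕ (w ⟨$⟩ʳ i))))

sameBox : Step → Step → Bool
sameBox (r , c , _) (r' , c' , _) = (r ≡ᵇ r') ∧ (c ≡ᵇ c')

crossings : ℕ → Crosses → ℕ → ℕ → ℕ
crossings n D a b =
  length (filter (λ s → isCrossBox s Data.Bool.≟ true)
                 (pipePath n D a))
  where
  isCrossBox : Step → Bool
  isCrossBox s@(r , c , _) = D r c ∧ any (sameBox s) (pipePath n D b)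

IsReduced : ℕ → Crosses → Set
IsReduced n D = ∀ a b → 1 ≤ a → a ≤ n → 1 ≤ b → b ≤ n → a ≢ b → crossings n D a b ≤ 1

InRP : (n : ℕ) → Permutation′ n → Crosses → Set
InRP n w D = IsPipeDreamFor n w D × IsReduced n D

cols : ℕ → List ℕ
cols n = map suc (upTo n)

rowCrosses : ℕ → Crosses → ℕ → List ℕ
rowCrosses n D i = filter (λ j → D i j Data.Bool.≟ true) (cols n)

wt : ℕ → Crosses → ℕ → ℕ
wt n D i = length (rowCrosses n D i)

-- pair cross (i,j) with the leftmost not-yet-paired cross of row i+1 in a
-- column ≥ j (removing it from the list of not-yet-paired crosses)
removeFirstGE : ℕ → List ℕ → List ℕ
removeFirstGE j [] = []
removeFirstGE j (x ∷ xs) = if j ≤ᵇ x then xs else x ∷ removeFirstGE j xs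

-- unpaired crosses of row i+1 (left to right); crosses of row i are
-- processed from right to left
unpaired : ℕ → Crosses → ℕ → List ℕ
unpaired n D i =
  foldl (λ acc j → removeFirstGE j acc) (rowCrosses n D (suc i))
        (reverse (rowCrosses n D i))

lastOf : ℕ → List ℕ → ℕ
lastOf x [] = x
lastOf x (y ∷ ys) = lastOf y ys

-- minimal column c' ≥ c with f c' ≡ false (search with fuel; for a pipe
-- dream every column > n is free, so fuel n starting from c ≥ 2 suffices)
nextFree : (ℕ → Bool) → ℕ → ℕ → ℕ
nextFree f c zero = c
nextFree f c (suc k) = if f c then nextFree f (suc c) k else c

-- e_i(D); nothing encodes e_i(D) = 0
raise : ℕ → ℕ → Crosses → Maybe Crosses
raise n i D with unpaired n D i
... | [] = nothing
... | x ∷ xs = just D'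
  where
  ℓ : ℕ
  ℓ = lastOf x xs          -- rightmost unpaired cross of row i+1
  q : ℕ
  q = nextFree (D (suc i)) (suc ℓ) n
  D' : Crosses
  D' a b = if (a ≡ᵇ suc i) ∧ (b ≡ᵇ ℓ) then false
           else if (a ≡ᵇ i) ∧ (b ≡ᵇ q) then true
           else D a b

IsHighestWeight : ℕ → Crosses → Set
IsHighestWeight n D = ∀ i → 1 ≤ i → i < n → raise n i D ≡ nothing

-- k-th element (0-indexed) of a list
nth : List ℕ → ℕ → Maybe ℕ
nth [] k = nothing
nth (x ∷ xs) zero = just x
nth (x ∷ xs) (suc k) = nth xs k

{-# OPTIONS --safe #-}

-- In a highest weight pipe dream every cross of row i+1 is paired with a cross of row i weakly
-- to its left, so for every column t, row i has at least as many crosses in columns ≤ t as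
-- row i+1. For sorted lists this domination of counting functions says that the ℓ-th cross of
-- row i lies weakly left of the ℓ-th cross of row i+1. Iterating over rows gives j ≤ j′, and
-- i < i′ makes j + i < j′ + i′.

module Submission where

open import Defs
open import Data.Nat using (ℕ; zero; suc; _+_; _∸_; _≤_; _<_; _≤?_; _≤ᵇ_; z≤n; s≤s; s≤s⁻¹; _≤′_; ≤′-refl; ≤′-step)
open import Data.Nat.Properties
open import Algebra.Properties.CommutativeSemigroup +-commutativeSemigroup using (x∙yz≈y∙xz)
open import Data.Bool using (true; false)
open import Data.List using (List; []; _∷_; _++_; [_]; length; filter; foldr)
open import Data.List.Properties using (length-++; filter-++; filter-accept; filter-reject; filter-none; reverse-foldl)
open import Data.List.Relation.Unary.All as All using (All; _∷_)
open import Data.List.Relation.Unary.AllPairs using (AllPairs; _∷_)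
import Data.List.Relation.Unary.AllPairs.Properties as AllPairs
open import Data.Maybe using (just; nothing)
open import Data.Product using (∃-syntax; _×_; _,_)
open import Data.Fin.Permutation using (Permutation′)
open import Function using (id)
open import Relation.Binary.PropositionalEquality using (_≡_; refl; sym; trans; cong)
open import Relation.Nullary using (¬_; yes; no; contradiction)
open import Relation.Nullary.Reflects using (ofʸ)

count≤ : ℕ → List ℕ → ℕ
count≤ t xs = length (filter (_≤? t) xs)

count≤-++ : ∀ t xs ys → count≤ t (xs ++ ys) ≡ count≤ t xs + count≤ t ys
count≤-++ t xs ys = trans (cong length (filter-++ (_≤? t) xs ys)) (length-++ (filter (_≤? t) xs))

count≤-∷ : ∀ t x xs → count≤ t (x ∷ xs) ≡ count≤ t [ x ] + count≤ t xs
count≤-∷ t x = count≤-++ t [ x ]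

count≤-accept : ∀ {t x} xs → x ≤ t → count≤ t (x ∷ xs) ≡ suc (count≤ t xs)
count≤-accept {t} _ x≤t = cong length (filter-accept (_≤? t) x≤t)

count≤-reject : ∀ {t x} xs → ¬ x ≤ t → count≤ t (x ∷ xs) ≡ count≤ t xs
count≤-reject {t} _ x≰t = cong length (filter-reject (_≤? t) x≰t)

count≤-none : ∀ {t xs} → All (t <_) xs → count≤ t xs ≡ 0
count≤-none {t} t<xs = cong length (filter-none (_≤? t) (All.map <⇒≱ t<xs))

count≤-antitone-head : ∀ {t x y} ys → x ≤ y → count≤ t (y ∷ ys) ≤ count≤ t (x ∷ ys)
count≤-antitone-head {t} {x} {y} ys x≤y with y ≤? t
... | yes y≤t = ≤-reflexive (trans (count≤-accept ys y≤t) (sym (count≤-accept ys (≤-trans x≤y y≤t))))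
... | no  y≰t = begin
  count≤ t (y ∷ ys)            ≡⟨ count≤-reject ys y≰t ⟩
  count≤ t ys                  ≤⟨ m≤n+m _ _ ⟩
  count≤ t [ x ] + count≤ t ys ≡⟨ count≤-∷ t x ys ⟨
  count≤ t (x ∷ ys)            ∎
  where open ≤-Reasoning

removeFirstGE-count≤ : ∀ t x ys → count≤ t ys ≤ count≤ t (x ∷ removeFirstGE x ys)
removeFirstGE-count≤ t x []       = z≤n
removeFirstGE-count≤ t x (y ∷ ys) with x ≤ᵇ y | ≤ᵇ-reflects-≤ x y
... | true  | ofʸ x≤y = count≤-antitone-head ys x≤y
... | false | _       = begin
  count≤ t (y ∷ ys)                                 ≡⟨ count≤-∷ t y ys ⟩
  count≤ t [ y ] + count≤ t ys                      ≤⟨ +-monoʳ-≤ (count≤ t [ y ]) (removeFirstGE-count≤ t x ys) ⟩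
  count≤ t [ y ] + count≤ t (x ∷ rest)              ≡⟨ cong (count≤ t [ y ] +_) (count≤-∷ t x rest) ⟩
  count≤ t [ y ] + (count≤ t [ x ] + count≤ t rest) ≡⟨ x∙yz≈y∙xz (count≤ t [ y ]) (count≤ t [ x ]) (count≤ t rest) ⟩
  count≤ t [ x ] + (count≤ t [ y ] + count≤ t rest) ≡⟨ cong (count≤ t [ x ] +_) (count≤-∷ t y rest) ⟨
  count≤ t [ x ] + count≤ t (y ∷ rest)              ≡⟨ count≤-∷ t x (y ∷ rest) ⟨
  count≤ t (x ∷ y ∷ rest)                           ∎
  where
  open ≤-Reasoning
  rest = removeFirstGE x ys

count≤-pairing : ∀ t xs ys → count≤ t ys ≤ count≤ t xs + count≤ t (foldr removeFirstGE ys xs)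
count≤-pairing t []       ys = ≤-refl
count≤-pairing t (x ∷ xs) ys = begin
  count≤ t ys                                     ≤⟨ count≤-pairing t xs ys ⟩
  count≤ t xs + count≤ t rest                     ≤⟨ +-monoʳ-≤ (count≤ t xs) (removeFirstGE-count≤ t x rest) ⟩
  count≤ t xs + count≤ t (x ∷ rest′)              ≡⟨ cong (count≤ t xs +_) (count≤-∷ t x rest′) ⟩
  count≤ t xs + (count≤ t [ x ] + count≤ t rest′) ≡⟨ x∙yz≈y∙xz (count≤ t xs) (count≤ t [ x ]) (count≤ t rest′) ⟩
  count≤ t [ x ] + (count≤ t xs + count≤ t rest′) ≡⟨ +-assoc (count≤ t [ x ]) (count≤ t xs) (count≤ t rest′) ⟨
  count≤ t [ x ] + count≤ t xs + count≤ t rest′   ≡⟨ cong (_+ count≤ t rest′) (count≤-∷ t x xs) ⟨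
  count≤ t (x ∷ xs) + count≤ t rest′              ∎
  where
  open ≤-Reasoning
  rest  = foldr removeFirstGE ys xs
  rest′ = removeFirstGE x rest

complete-pairing⇒count≤ : ∀ t xs ys → foldr removeFirstGE ys xs ≡ [] → count≤ t ys ≤ count≤ t xs
complete-pairing⇒count≤ t xs ys unpaired≡[] = begin
  count≤ t ys                                        ≤⟨ count≤-pairing t xs ys ⟩
  count≤ t xs + count≤ t (foldr removeFirstGE ys xs) ≡⟨ cong (λ zs → count≤ t xs + count≤ t zs) unpaired≡[] ⟩
  count≤ t xs + 0                                    ≡⟨ +-identityʳ (count≤ t xs) ⟩
  count≤ t xs                                        ∎
  where open ≤-Reasoning

Sorted : List ℕ → Set
Sorted = AllPairs _≤_

nth-All : ∀ {P : ℕ → Set} {xs k b} → All P xs → nth xs k ≡ just b → P b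
nth-All {xs = _ ∷ _} {zero}  (px ∷ _)  refl = px
nth-All {xs = _ ∷ _} {suc k} (_ ∷ pxs) eq   = nth-All pxs eq

nth⇒count≤ : ∀ {xs} k {b} → Sorted xs → nth xs k ≡ just b → suc k ≤ count≤ b xs
nth⇒count≤ {x ∷ xs} zero    _          refl =
  ≤-trans (s≤s z≤n) (≤-reflexive (sym (count≤-accept {x} xs ≤-refl)))
nth⇒count≤ {x ∷ xs} (suc k) (x≤xs ∷ s) eq   =
  ≤-trans (s≤s (nth⇒count≤ k s eq)) (≤-reflexive (sym (count≤-accept xs (nth-All x≤xs eq))))

count≤⇒nth : ∀ {xs} k {b} → Sorted xs → suc k ≤ count≤ b xs → ∃[ a ] nth xs k ≡ just a × a ≤ b
count≤⇒nth {x ∷ xs} k {b} (x≤xs ∷ s) k<count with x ≤? b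
count≤⇒nth {x ∷ xs} zero    {b} (x≤xs ∷ s) k<count | yes x≤b = x , refl , x≤b
count≤⇒nth {x ∷ xs} (suc k) {b} (x≤xs ∷ s) k<count | yes x≤b =
  count≤⇒nth k s (s≤s⁻¹ (≤-trans k<count (≤-reflexive (count≤-accept xs x≤b))))
count≤⇒nth {x ∷ xs} k {b} (x≤xs ∷ s) k<count | no x≰b =
  contradiction (≤-trans k<count (≤-reflexive (count≤-none (b<x ∷ All.map (<-≤-trans b<x) x≤xs)))) n≮0
  where b<x = ≰⇒> x≰b

_⊴_ : List ℕ → List ℕ → Set
xs ⊴ ys = ∀ k {b} → nth ys k ≡ just b → ∃[ a ] nth xs k ≡ just a × a ≤ b

⊴-refl : ∀ xs → xs ⊴ xs
⊴-refl _ k {b} nb = b , nb , ≤-refl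

⊴-trans : ∀ xs ys zs → xs ⊴ ys → ys ⊴ zs → xs ⊴ zs
⊴-trans _ _ _ xs⊴ys ys⊴zs k nc with b , nb , b≤c ← ys⊴zs k nc with a , na , a≤b ← xs⊴ys k nb =
  a , na , ≤-trans a≤b b≤c

count≤-dominated⇒⊴ : ∀ {xs ys} → Sorted xs → Sorted ys →
                     (∀ t → count≤ t ys ≤ count≤ t xs) → xs ⊴ ys
count≤-dominated⇒⊴ xs↗ ys↗ dominated k {b} nb =
  count≤⇒nth k xs↗ (≤-trans (nth⇒count≤ k ys↗ nb) (dominated b))

rowCrosses-sorted : ∀ n D i → Sorted (rowCrosses n D i)
rowCrosses-sorted n D i =
  AllPairs.filter⁺ _ (AllPairs.map⁺ (AllPairs.applyUpTo⁺₁ id n (λ i<j _ → s≤s (<⇒≤ i<j))))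

raise≡nothing⇒unpaired≡[] : ∀ n i D → raise n i D ≡ nothing → unpaired n D i ≡ []
raise≡nothing⇒unpaired≡[] n i D raise≡nothing with unpaired n D i
... | []    = refl
... | _ ∷ _ with () ← raise≡nothing

unpaired≡foldr : ∀ n D i →
                 unpaired n D i ≡ foldr removeFirstGE (rowCrosses n D (suc i)) (rowCrosses n D i)
unpaired≡foldr n D i =
  reverse-foldl (λ acc j → removeFirstGE j acc) (rowCrosses n D (suc i)) (rowCrosses n D i)

highestWeight⇒row⊴nextRow : ∀ {n D i} → IsHighestWeight n D → 1 ≤ i → i < n →
                            rowCrosses n D i ⊴ rowCrosses n D (suc i)
highestWeight⇒row⊴nextRow {n} {D} {i} hw 1≤i i<n =
  count≤-dominated⇒⊴ (rowCrosses-sorted n D i) (rowCrosses-sorted n D (suc i)) λ t →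
    complete-pairing⇒count≤ t (rowCrosses n D i) (rowCrosses n D (suc i))
      (trans (sym (unpaired≡foldr n D i)) (raise≡nothing⇒unpaired≡[] n i D (hw i 1≤i i<n)))

highestWeight⇒row⊴row : ∀ {n D i i′} → IsHighestWeight n D → 1 ≤ i → i ≤ i′ → i′ ≤ n →
                        rowCrosses n D i ⊴ rowCrosses n D i′
highestWeight⇒row⊴row {n} {D} {i} hw 1≤i i≤i′ i′≤n = go (≤⇒≤′ i≤i′) i′≤n
  where
  go : ∀ {m} → i ≤′ m → m ≤ n → rowCrosses n D i ⊴ rowCrosses n D m
  go ≤′-refl        _     = ⊴-refl (rowCrosses n D i)
  go (≤′-step i≤′m) 1+m≤n = ⊴-trans (rowCrosses n D i) (rowCrosses n D _) (rowCrosses n D _)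
    (go i≤′m (<⇒≤ 1+m≤n)) (highestWeight⇒row⊴nextRow hw (≤-trans 1≤i (≤′⇒≤ i≤′m)) 1+m≤n)

lemma6p3 : (n : ℕ) (w : Permutation′ n) (D : Crosses) →
    InRP n w D → IsHighestWeight n D →
    ∀ (ℓ i i′ j j′ : ℕ) → 1 ≤ ℓ → ℓ ≤ wt n D 1 →
    1 ≤ i → i < i′ → i′ ≤ n →
    nth (rowCrosses n D i) (ℓ ∸ 1) ≡ just j →
    nth (rowCrosses n D i′) (ℓ ∸ 1) ≡ just j′ →
    (j + i) ∸ 1 < (j′ + i′) ∸ 1
lemma6p3 n w D _ hw ℓ i i′ j j′ _ _ 1≤i i<i′ i′≤n nj nj′
  with a , na , a≤j′ ← highestWeight⇒row⊴row hw 1≤i (<⇒≤ i<i′) i′≤n (ℓ ∸ 1) nj′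
  with refl ← trans (sym nj) na
  = ∸-monoˡ-< (+-mono-≤-< a≤j′ i<i′) (≤-trans 1≤i (m≤n+m i j))
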